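{- Let $D$ be a finite or infinite digraph and let $A\subseteq X(D)$. (a) The following are equivalent: (i) $A$ is a point-reaching set of $D$; (ii) $A^*$ is a point-reaching set of the condensation $D^*$; (iii) $A$ contains at least one vertex from each initial strong component of $D$, and $A\cap R'(u)\neq\emptyset$ for every vertex $u$ of $D$ whose shadow $R'(u)$ contains no initial strong component of $D$; (iv) $A$ contains at least one vertex from each initial strong component of $D$, and $A\cap R'(u)$ is infinite for every vertex $u$ of $D$ whose shadow $R'(u)$ contains no initial strong component of $D$. (b) Every point-basis of $D$ (if one exists) consists of exactly one vertex from each initial strong component of $D$ and no other vertices.
   Context: $D$ is a digraph with vertex set $X(D)$ (arcs are ordered pairs of distinct vertices), possibly infinite. $v$ is reachable from $u$ if there is a directed path (possibly of length $0$) from $u$ to $v$. The shadow of $u$ is $R'(u)=\{z\in X(D): u \text{ is reachable from } z\}$. A strong component is a maximal subdigraph in which every vertex is reachable from every other; it is initial if no arc of $D$ enters it from outside. The condensation $D^*$ has one vertex for each strong component of $D$, with an arc $(C_1,C_2)$ iff $C_1\ne C_2$ and some arc $(u,v)$ of $D$ has $u\in C_1$, $v\in C_2$. For $S\subseteq X(D)$, $S^*$ is the set of strong components of $D$ meeting $S$ (a vertex set of $D^*$). A point-reaching set of a digraph is a vertex set $S$ such that every vertex is reachable from some vertex of $S$; a point-basis is an inclusion-minimal point-reaching set. -}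

module Defs where

open import Data.Product using (Σ; ∃; ∃-syntax; _×_; _,_)
open import Data.List using (List)
open import Data.List.Membership.Propositional using (_∈_)
open import Relation.Nullary using (¬_)
open import Relation.Binary.PropositionalEquality using (_≡_)
open import Relation.Binary.Construct.Closure.ReflexiveTransitive using (Star)

-- A digraph is given by a vertex type X (possibly infinite) and an arc
-- relation E : X → X → Set  (E u v = "there is an arc (u,v)").
-- Subsets of X are predicates X → Set.

module _ {X : Set} (E : X → X → Set) where

  Reach : X → X → Set
  Reach u v = Star E u v

  Shadow : X → X → Set
  Shadow u z = Reach z u

  -- mutual reachability; strong components are exactly its classes.
  -- A strong component is represented by any of its vertices c:
  -- its vertex set is  { x | x ~ c }.
  _~_ : X → X → Set
  x ~ y = Reach x y × Reach y x

  IsInitial : X → Set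
  IsInitial c = ∀ u v → E u v → v ~ c → u ~ c

  PointReaching : (X → Set) → Set
  PointReaching S = ∀ v → ∃[ s ] (S s × Reach s v)

  PointBasis : (X → Set) → Set₁
  PointBasis S = PointReaching S
    × (∀ (T : X → Set) → (∀ x → T x → S x) → PointReaching T → ∀ x → S x → T x)

  -- condensation D*: vertices are strong components, represented by
  -- vertices of D up to _~_ ; arc (C₁,C₂) iff C₁ ≠ C₂ and some arc of D
  -- goes from C₁ to C₂.
  CondArc : X → X → Set
  CondArc x y = ¬ (x ~ y) × ∃[ u ] ∃[ v ] (u ~ x × v ~ y × E u v)

  -- S* : the strong components meeting S (as a ~-closed set of representatives)
  Star* : (X → Set) → X → Set
  Star* S x = ∃[ s ] (S s × s ~ x)

  ShadowContainsInitial : X → Set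
  ShadowContainsInitial u = ∃[ c ] (IsInitial c × (∀ x → x ~ c → Shadow u x))

Finite : {X : Set} → (X → Set) → Set
Finite {X} P = ∃[ xs ] (∀ (x : X) → P x → x ∈ xs)

Infinite : {X : Set} → (X → Set) → Set
Infinite P = ¬ Finite P

module Submission where

open import Defs
open import Level using (0ℓ)
open import Data.Product using (∃; ∃-syntax; _×_; _,_; proj₁; proj₂)
open import Data.List using ([]; _∷_)
open import Data.List.Membership.Propositional using (_∈_)
open import Data.List.Relation.Unary.Any using (here; there)
open import Data.List.Relation.Unary.Any.Properties using (¬Any[])
open import Data.Empty using (⊥-elim)
open import Function.Bundles using (_⇔_; mk⇔)
open import Relation.Nullary using (¬_; yes; no)
open import Relation.Binary.Definitions using (Reflexive; Transitive)
open import Relation.Binary.PropositionalEquality using (_≡_; _≢_; refl; sym)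
open import Relation.Binary.Construct.Closure.ReflexiveTransitive using (Star; ε; _◅_; _◅◅_)
open import Axiom.ExcludedMiddle using (ExcludedMiddle)
open import Axiom.DoubleNegationElimination using (em⇒dne)

-- A vertex of a point-reaching set A that is ⇝-minimal in A has an initial
-- strong component: anything entering that component is reached from A,
-- hence (by minimality) from the vertex itself. In a finite nonempty
-- A ∩ R'(u) such a minimal vertex exists, so R'(u) contains an initial
-- component; this gives (i) ⇒ (iv). In a point-basis no element reaches
-- another one, since the reached element could be dropped; this gives (b).

module Reachability {X : Set} (E : X → X → Set) where

  infix 4 _⇝_ _≈_

  _⇝_ : X → X → Set
  _⇝_ = Reach E

  _≈_ : X → X → Set
  _≈_ = _~_ E

  ≈-refl : Reflexive _≈_
  ≈-refl = ε , ε

  ≈-sym : ∀ {x y} → x ≈ y → y ≈ x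
  ≈-sym (p , q) = q , p

  ≈-trans : Transitive _≈_
  ≈-trans (p , q) (p′ , q′) = p ◅◅ p′ , q′ ◅◅ q

  condensation-path⇒path : ∀ {x y} → Star (CondArc E) x y → x ⇝ y
  condensation-path⇒path ε = ε
  condensation-path⇒path ((_ , _ , _ , u≈x , v≈y , e) ◅ p) =
    proj₂ u≈x ◅◅ e ◅ proj₁ v≈y ◅◅ condensation-path⇒path p

  initial-closed-backwards : ∀ {c s w} → IsInitial E c → s ⇝ w → w ≈ c → s ≈ c
  initial-closed-backwards ic ε w≈c = w≈c
  initial-closed-backwards ic (_◅_ {i = s} {j = t} e p) w≈c =
    ic s t e (initial-closed-backwards ic p w≈c)

  condensation⇒pointReaching : (A : X → Set) →
    PointReaching (CondArc E) (Star* E A) → PointReaching E A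
  condensation⇒pointReaching A pr v with pr v
  ... | _ , (s , s∈A , s≈x) , p = s , s∈A , proj₁ s≈x ◅◅ condensation-path⇒path p

  pointReaching⇒meets-initial : (A : X → Set) → PointReaching E A →
    ∀ c → IsInitial E c → ∃[ a ] (A a × a ≈ c)
  pointReaching⇒meets-initial A pr c ic with pr c
  ... | s , s∈A , s⇝c = s , s∈A , initial-closed-backwards ic s⇝c ≈-refl

  minimal-initial : (A : X → Set) → PointReaching E A →
    ∀ {m} → (∀ s → A s → s ⇝ m → m ⇝ s) → IsInitial E m
  minimal-initial A pr minimal z w e w≈m with pr z
  ... | s , s∈A , s⇝z = z⇝m , minimal s s∈A (s⇝z ◅◅ z⇝m) ◅◅ s⇝z
    where z⇝m = e ◅ proj₁ w≈m

module _ (lem : ExcludedMiddle 0ℓ) where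

  private
    dne = em⇒dne lem

  infinite⇒nonempty : {X : Set} (P : X → Set) → Infinite P → ∃ P
  infinite⇒nonempty P infinite =
    dne λ empty → infinite ([] , λ x Px → ⊥-elim (empty (x , Px)))

  module _ {X : Set} {_≲_ : X → X → Set} (≲-refl : Reflexive _≲_)
           (≲-trans : Transitive _≲_) (P : X → Set) where

    Minimal : X → Set
    Minimal m = P m × (∀ f → P f → f ≲ m → m ≲ f)

    private
      StrictlyBelow : X → X → Set
      StrictlyBelow y f = P f × f ≲ y × ¬ y ≲ f

    -- Induction on a list covering everything strictly below the current
    -- candidate; passing to a strictly smaller candidate shrinks that set.
    minimal-below : ∀ ys y → P y → (∀ f → StrictlyBelow y f → f ∈ ys) → ∃ Minimal
    minimal-below [] y Py covered =
      y , Py , λ f Pf f≲y → dne λ y≴f → ¬Any[] (covered f (Pf , f≲y , y≴f))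
    minimal-below (z ∷ zs) y Py covered with lem {StrictlyBelow y z}
    ... | no z≮y = minimal-below zs y Py covered′
      where
        covered′ : ∀ f → StrictlyBelow y f → f ∈ zs
        covered′ f f<y with covered f f<y
        ... | here refl = ⊥-elim (z≮y f<y)
        ... | there f∈zs = f∈zs
    ... | yes (Pz , z≲y , y≴z) = minimal-below zs z Pz covered′
      where
        covered′ : ∀ f → StrictlyBelow z f → f ∈ zs
        covered′ f (Pf , f≲z , z≴f)
          with covered f (Pf , ≲-trans f≲z z≲y , λ y≲f → y≴z (≲-trans y≲f f≲z))
        ... | here refl = ⊥-elim (z≴f ≲-refl)
        ... | there f∈zs = f∈zs

    finite⇒minimal : Finite P → ∃ P → ∃ Minimal
    finite⇒minimal (xs , covers) (y , Py) =
      minimal-below xs y Py λ f f<y → covers f (proj₁ f<y)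

  module Classical {X : Set} (E : X → X → Set) where

    open Reachability E

    path⇒condensation-path : ∀ {s v} → s ⇝ v → ∃[ x ] (s ≈ x × Star (CondArc E) x v)
    path⇒condensation-path ε = _ , ≈-refl , ε
    path⇒condensation-path {s} (_◅_ {j = t} e p) with path⇒condensation-path p | lem {s ≈ t}
    ... | x , t≈x , q | yes s≈t = x , ≈-trans s≈t t≈x , q
    ... | x , t≈x , q | no s≉t = s , ≈-refl , cross ◅ q
      where
        cross : CondArc E s x
        cross = (λ s≈x → s≉t (≈-trans s≈x (≈-sym t≈x))) , s , t , ≈-refl , t≈x , e

    pointReaching⇒condensation : (A : X → Set) →
      PointReaching E A → PointReaching (CondArc E) (Star* E A)
    pointReaching⇒condensation A pr v with pr v
    ... | s , s∈A , s⇝v with path⇒condensation-path s⇝v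
    ...   | x , s≈x , p = x , (s , s∈A , s≈x) , p

    meets-initial⇒pointReaching : (A : X → Set) →
      (∀ c → IsInitial E c → ∃[ a ] (A a × a ≈ c)) →
      (∀ u → ¬ ShadowContainsInitial E u → ∃[ a ] (A a × Shadow E u a)) →
      PointReaching E A
    meets-initial⇒pointReaching A meets reaches v with lem {ShadowContainsInitial E v}
    ... | no ¬initial = reaches v ¬initial
    ... | yes (c , ic , c⊆R′v) with meets c ic
    ...   | a , a∈A , a≈c = a , a∈A , c⊆R′v a a≈c

    pointReaching⇒shadow-infinite : (A : X → Set) → PointReaching E A →
      ∀ u → ¬ ShadowContainsInitial E u → Infinite (λ a → A a × Shadow E u a)
    pointReaching⇒shadow-infinite A pr u ¬initial finite
      with finite⇒minimal ε _◅◅_ (λ a → A a × Shadow E u a) finite (pr u)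
    ... | m , (m∈A , m⇝u) , minimal =
      ¬initial (m , minimal-initial A pr minimalᴬ , λ x x≈m → proj₁ x≈m ◅◅ m⇝u)
      where
        minimalᴬ : ∀ s → A s → s ⇝ m → m ⇝ s
        minimalᴬ s s∈A s⇝m = minimal s (s∈A , s⇝m ◅◅ m⇝u) s⇝m

    pointReaching-without : (B : X → Set) → PointReaching E B →
      ∀ {s b} → B s → s ≢ b → s ⇝ b → PointReaching E (λ x → B x × x ≢ b)
    pointReaching-without B pr {s} {b} s∈B s≢b s⇝b v with pr v
    ... | t , t∈B , t⇝v with lem {t ≡ b}
    ...   | no t≢b = t , (t∈B , t≢b) , t⇝v
    ...   | yes refl = s , (s∈B , s≢b) , s⇝b ◅◅ t⇝v

    basis-reaches-only-itself : (B : X → Set) → PointBasis E B →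
      ∀ {s b} → B s → B b → s ⇝ b → s ≡ b
    basis-reaches-only-itself B (pr , minimal) {s} {b} s∈B b∈B s⇝b = dne λ s≢b →
      proj₂ (minimal _ (λ _ → proj₁) (pointReaching-without B pr s∈B s≢b s⇝b) b b∈B) refl

    basis-element-initial : (B : X → Set) → PointBasis E B →
      ∀ b → B b → IsInitial E b
    basis-element-initial B basis@(pr , _) b b∈B u v e v≈b with pr u
    ... | s , s∈B , s⇝u
      with basis-reaches-only-itself B basis s∈B b∈B (s⇝u ◅◅ e ◅ proj₁ v≈b)
    ...   | refl = e ◅ proj₁ v≈b , s⇝u

    basis-meets-initial-once : (B : X → Set) → PointBasis E B →
      ∀ c → IsInitial E c →
      ∃[ b ] ((B b × b ≈ c) × (∀ b′ → B b′ → b′ ≈ c → b′ ≡ b))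
    basis-meets-initial-once B basis@(pr , _) c ic
      with pointReaching⇒meets-initial B pr c ic
    ... | b , b∈B , b≈c = b , (b∈B , b≈c) , λ b′ b′∈B b′≈c →
      sym (basis-reaches-only-itself B basis b∈B b′∈B (proj₁ (≈-trans b≈c (≈-sym b′≈c))))

-- Loops do not affect reachability.
theorem14 : ExcludedMiddle 0ℓ →
    (X : Set) (E : X → X → Set) → (∀ x → ¬ E x x) →
    ((A : X → Set) →
      let cond3 = (∀ c → IsInitial E c → ∃[ a ] (A a × _~_ E a c))
                  × (∀ u → ¬ ShadowContainsInitial E u → ∃[ a ] (A a × Shadow E u a))
          cond4 = (∀ c → IsInitial E c → ∃[ a ] (A a × _~_ E a c))
                  × (∀ u → ¬ ShadowContainsInitial E u → Infinite (λ a → A a × Shadow E u a))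
      in (PointReaching E A ⇔ PointReaching (CondArc E) (Star* E A))
         × (PointReaching E A ⇔ cond3)
         × (PointReaching E A ⇔ cond4))
    × ((B : X → Set) → PointBasis E B →
         (∀ c → IsInitial E c →
            ∃[ b ] ((B b × _~_ E b c) × (∀ b′ → B b′ → _~_ E b′ c → b′ ≡ b)))
         × (∀ b → B b → ∃[ c ] (IsInitial E c × _~_ E b c)))
theorem14 lem X E _ =
    (λ A →
        mk⇔ (pointReaching⇒condensation A) (condensation⇒pointReaching A)
      , mk⇔ (λ pr → pointReaching⇒meets-initial A pr , λ u _ → pr u)
            (λ (meets , reaches) → meets-initial⇒pointReaching A meets reaches)
      , mk⇔ (λ pr → pointReaching⇒meets-initial A pr , pointReaching⇒shadow-infinite A pr)
            (λ (meets , infinite) → meets-initial⇒pointReaching A meets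
               λ u ¬initial → infinite⇒nonempty lem _ (infinite u ¬initial)))
  , λ B basis →
        basis-meets-initial-once B basis
      , λ b b∈B → b , basis-element-initial B basis b b∈B , ≈-refl
  where
    open Reachability E
    open Classical lem E
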